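{- For every triple of positive integers $n,k,t$ with $t\ge n$ and $\frac{n(n+1)}{2}=k\cdot t$, the algorithm $\Pi\mathit{Solve}(n,k,t)$ described in the context terminates and outputs sets $T_1,\dots,T_k$ which form a $(k,t)$-partition of $\{1,\dots,n\}$, i.e. the $T_j$ are pairwise disjoint, $\bigcup_{j=1}^k T_j=\{1,\dots,n\}$, and $\sum_{x\in T_j}x=t$ for every $j\in\{1,\dots,k\}$.
   Context: A problem instance $\Pi(n,k,t)$ consists of positive integers $n,k,t$ with $t\ge n$ and $\Delta_n:=\frac{n(n+1)}{2}=k\cdot t$. Let $I_n=\{1,\dots,n\}$. Meander algorithms. If $2k\mid n$: for $1\le j\le k$ put $T_j=\{2ki-(j-1),\ 2k(i-1)+j : 1\le i\le \frac{n}{2k}\}$. If $2k\mid n+1$: for $1\le j\le k$ put $T_j=\{2ki-j,\ 2k(i-1)+(j-1) : 1\le i\le \frac{n+1}{2k}\}$ (the element $0$, which lands in $T_1$, is discarded). Algorithm $\Pi\mathit{Solve}(n,k,t)$ distinguishes the following cases, tested in this order: (I) if $2k\mid n$ or $2k\mid n+1$, output the corresponding meander sets and stop; (II) else if $t\ge 2n$: set $T_{j,1}=\{n-2k+j,\ n-(j-1)\}$ for $1\le j\le k$, obtain sets $T_{1,2},\dots,T_{k,2}$ by $\Pi\mathit{Solve}(n-2k,\ k,\ t-2(n-k)-1)$, and output $T_j=T_{j,1}\cup T_{j,2}$; (III) else if $t<2n$ and $t$ even: set $T_j=\{t-n+(j-1),\ n-(j-1)\}$ for $1\le j\le \frac{2n-t}{2}$;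 each remaining set $T_j$, $\frac{2n-t}{2}+1\le j\le k$, is split into two halves $T_{j,1},T_{j,2}$; set $T_{\frac{2n-t}{2}+1,1}=\{t/2\}$; the remaining $2(k-n)+t-1$ halves are filled by the output of $\Pi\mathit{Solve}(t-n-1,\ 2(k-n)+t-1,\ t/2)$, and each such $T_j$ is the union of its two halves; (IV) else ($t<2n$ and $t$ odd): set $T_j=\{t-n+(j-1),\ n-(j-1)\}$ for $1\le j\le \frac{2n-t+1}{2}$, and fill the remaining sets $T_j$, $\frac{2n-t+1}{2}+1\le j\le k$, by $\Pi\mathit{Solve}(t-n-1,\ k-\frac{2n-t+1}{2},\ t)$. -}

module Defs where

open import Data.Nat using (ℕ; zero; suc; _+_; _*_; _∸_; _≤_; _≤?_; ⌊_/2⌋)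
open import Data.Nat.Divisibility using (_∣?_; divides)
open import Data.List using (List; []; _∷_; _++_; map; concatMap; upTo; filter; zipWith; length; lookup)
open import Data.Nat.ListAction using (sum)
open import Data.Maybe using (Maybe; just; nothing)
open import Data.Product using (Σ; ∃; _×_; _,_)
open import Data.Fin using (Fin)
open import Data.List.Membership.Propositional using (_∈_; _∉_)
open import Data.List.Relation.Unary.Unique.Propositional using (Unique)
open import Relation.Nullary using (¬_; yes; no; ¬?)
open import Relation.Binary.PropositionalEquality using (_≡_)
import Data.Nat as ℕ

from1 : ℕ → List ℕ
from1 q = map suc (upTo q)

-- Meander sets, case 2k ∣ n, with q = n / (2k):
-- T_j = { 2ki-(j-1), 2k(i-1)+j : 1 ≤ i ≤ q },  1 ≤ j ≤ k
meanderEven : ℕ → ℕ → List (List ℕ)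
meanderEven k q =
  map (λ j → concatMap (λ i → (2 * k * i ∸ (j ∸ 1)) ∷ (2 * k * (i ∸ 1) + j) ∷ []) (from1 q)) (from1 k)

-- Meander sets, case 2k ∣ n+1, with q = (n+1) / (2k):
-- T_j = { 2ki-j, 2k(i-1)+(j-1) : 1 ≤ i ≤ q },  1 ≤ j ≤ k, element 0 discarded
meanderOdd : ℕ → ℕ → List (List ℕ)
meanderOdd k q =
  map (λ j → filter (λ x → ¬? (x ℕ.≟ 0))
                (concatMap (λ i → (2 * k * i ∸ j) ∷ (2 * k * (i ∸ 1) + (j ∸ 1)) ∷ []) (from1 q)))
      (from1 k)

pairSets : ℕ → ℕ → ℕ → List (List ℕ)
pairSets n t m = map (λ j → (t ∸ n + (j ∸ 1)) ∷ (n ∸ (j ∸ 1)) ∷ []) (from1 m)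

pairUp : List (List ℕ) → List (List ℕ)
pairUp (a ∷ b ∷ rest) = (a ++ b) ∷ pairUp rest
pairUp (a ∷ []) = a ∷ []
pairUp [] = []

-- ΠSolve with an explicit fuel parameter; `nothing` means "did not
-- terminate within the given number of recursive calls".
piSolve : (fuel : ℕ) → (n k t : ℕ) → Maybe (List (List ℕ))
piSolve zero n k t = nothing
piSolve (suc f) n k t with (2 * k) ∣? n
... | yes (divides q _) = just (meanderEven k q)
... | no _ with (2 * k) ∣? (n + 1)
...   | yes (divides q _) = just (meanderOdd k q)
...   | no _ with 2 * n ≤? t
...     | yes _ with piSolve f (n ∸ 2 * k) k (t ∸ 2 * (n ∸ k) ∸ 1)
...       | nothing = nothing
...       | just R = just (zipWith _++_
                         (map (λ j → (n ∸ 2 * k + j) ∷ (n ∸ (j ∸ 1)) ∷ []) (from1 k)) R)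
piSolve (suc f) n k t | no _ | no _ | no _ with 2 ∣? t
-- (III) t < 2n, t even, t = 2h; m = (2n-t)/2 = n - h;
--       2(k-n)+t-1 = (2k+t) - (1+2n) halves filled recursively
... | yes (divides h _) with piSolve f (t ∸ n ∸ 1) ((2 * k + t) ∸ (1 + 2 * n)) h
...   | nothing = nothing
...   | just R = just (pairSets n t (n ∸ h) ++ pairUp ((h ∷ []) ∷ R))
piSolve (suc f) n k t | no _ | no _ | no _ | no _
  with piSolve f (t ∸ n ∸ 1) (k ∸ ⌊ (2 * n + 1 ∸ t) /2⌋) t
... | nothing = nothing
... | just R = just (pairSets n t ⌊ (2 * n + 1 ∸ t) /2⌋ ++ R)

PiSolveOutputs : ℕ → ℕ → ℕ → List (List ℕ) → Set
PiSolveOutputs n k t Ts = ∃ λ fuel → piSolve fuel n k t ≡ just Ts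

record IsKTPartition (n k t : ℕ) (Ts : List (List ℕ)) : Set where
  field
    count    : length Ts ≡ k
    areSets  : ∀ (i : Fin (length Ts)) → Unique (lookup Ts i)
    disjoint : ∀ (i j : Fin (length Ts)) → ¬ (i ≡ j) → ∀ x → x ∈ lookup Ts i → x ∉ lookup Ts j
    covers   : ∀ x → (1 ≤ x × x ≤ n) → Σ (Fin (length Ts)) (λ i → x ∈ lookup Ts i)
    within   : ∀ (i : Fin (length Ts)) x → x ∈ lookup Ts i → 1 ≤ x × x ≤ n
    sums     : ∀ (i : Fin (length Ts)) → sum (lookup Ts i) ≡ t

module Submission where

-- A solution of Π(n,k,t) is described by `Family Ts k t (range 1 n)`: k sets of sum t whose
-- concatenation is a rearrangement of 1..n, i.e. bag equal to it, where bags are compared by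
-- multiplicities (`mult`, `_≋_`); `Family⇒partition` turns this into a (k,t)-partition.
-- All sets built by the algorithm are assembled from pair lists {a+j, b-j}, which have a
-- constant sum and cover two intervals (`pairList-family`).  The meander cases follow by
-- interchanging the two indices of the meander and tiling 1..n by blocks of 2k consecutive
-- numbers.  Each recursive case is a `Reduction`: it sends an admissible instance (n ≤ t and
-- n(n+1) = 2kt) to a smaller admissible one and lifts its solutions back; the arithmetic of a
-- case is done after writing n, t, k in terms of free parameters (`caseX-decompose`,
-- `caseX-balance`).  Finally `solve` runs ΠSolve by induction on the fuel, which exceeds n.

open import Defs
open import Data.Nat using (ℕ; _*_; _≥_; _+_; suc; ⌊_/2⌋)
open import Data.List using (List)
open import Data.Product using (Σ; _×_)
open import Relation.Binary.PropositionalEquality using (_≡_)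

open import Level using (0ℓ)
open import Function using (_∘_)
open import Data.Nat using (zero; _∸_; _⊓_; _≤_; _<_; _≟_; _≤?_; z≤n; s≤s; z<s; >-nonZero)
open import Data.Nat.Divisibility using (_∣_; _∣?_; divides; _∣0)
open import Data.Nat.Properties
open import Data.Nat.ListAction using (sum)
open import Data.Nat.Tactic.RingSolver using (solve-∀)
open import Data.List using ([]; _∷_; _++_; [_]; map; concat; concatMap; length; lookup; applyUpTo; zipWith; filter)
open import Data.List.Properties
  using (map-∘; map-id; map-cong; concatMap-cong; length-map; length-++; length-zipWith; ++-assoc; concat-++; filter-++)
open import Data.Nat.ListAction.Properties using (sum-++)
open import Data.List.Relation.Unary.All as All using (All; []; _∷_)
open import Data.List.Relation.Unary.All.Properties using (¬Any⇒All¬; ++⁺)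
open import Data.List.Relation.Unary.Any using (here; there; index)
open import Data.List.Relation.Unary.Any.Properties using (lookup-index)
open import Data.List.Relation.Unary.AllPairs using ([]; _∷_)
open import Data.List.Membership.Propositional using (_∈_; _∉_)
open import Data.List.Membership.Propositional.Properties using (∈-lookup; ∈-concat⁻)
open import Data.List.Relation.Unary.Unique.Propositional using (Unique)
open import Data.Fin using () renaming (zero to fzero; suc to fsuc)
open import Data.Product using (_,_; ∃; ∃₂)
open import Data.Empty using (⊥-elim)
open import Data.Maybe using (just)
open import Data.Sum using (_⊎_; inj₁; inj₂)
open import Relation.Nullary using (¬_; yes; no; Dec; ¬?)
open import Relation.Binary.PropositionalEquality
  using (refl; sym; trans; cong; cong₂; subst; subst₂; _≢_; module ≡-Reasoning)
open import Relation.Binary.Bundles using (Setoid)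
open import Relation.Binary.Structures using (IsEquivalence)
import Relation.Binary.Reasoning.Setoid as SetoidReasoning

mult : ℕ → List ℕ → ℕ
mult x [] = 0
mult x (y ∷ ys) with x ≟ y
... | yes _ = suc (mult x ys)
... | no _ = mult x ys

mult-++ : ∀ x A B → mult x (A ++ B) ≡ mult x A + mult x B
mult-++ x [] B = refl
mult-++ x (y ∷ A) B with x ≟ y
... | yes _ = cong suc (mult-++ x A B)
... | no _ = mult-++ x A B

infix 4 _≋_
record _≋_ (A B : List ℕ) : Set where
  constructor ≋-by
  field mult-≡ : ∀ x → mult x A ≡ mult x B
open _≋_

≋-isEquivalence : IsEquivalence _≋_
≋-isEquivalence = record
  { refl  = ≋-by λ _ → refl
  ; sym   = λ p → ≋-by λ x → sym (mult-≡ p x)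
  ; trans = λ p q → ≋-by λ x → trans (mult-≡ p x) (mult-≡ q x)
  }

open IsEquivalence ≋-isEquivalence
  using () renaming (refl to ≋-refl; sym to ≋-sym; trans to ≋-trans; reflexive to ≋-reflexive)

≋-setoid : Setoid 0ℓ 0ℓ
≋-setoid = record { isEquivalence = ≋-isEquivalence }

module ≋-Reasoning = SetoidReasoning ≋-setoid

≋-++ : ∀ {A B C D} → A ≋ B → C ≋ D → A ++ C ≋ B ++ D
≋-++ {A} {B} {C} {D} p q = ≋-by λ x → begin
    mult x (A ++ C)      ≡⟨ mult-++ x A C ⟩
    mult x A + mult x C  ≡⟨ cong₂ _+_ (mult-≡ p x) (mult-≡ q x) ⟩
    mult x B + mult x D  ≡⟨ mult-++ x B D ⟨
    mult x (B ++ D)      ∎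
  where open ≡-Reasoning

++-comm-≋ : ∀ A B → A ++ B ≋ B ++ A
++-comm-≋ A B = ≋-by λ x →
  trans (mult-++ x A B) (trans (+-comm (mult x A) _) (sym (mult-++ x B A)))

++-interchange-≋ : ∀ A B C D → (A ++ B) ++ (C ++ D) ≋ (A ++ C) ++ (B ++ D)
++-interchange-≋ A B C D = begin
    (A ++ B) ++ (C ++ D)  ≡⟨ ++-assoc A B (C ++ D) ⟩
    A ++ (B ++ (C ++ D))  ≡⟨ cong (A ++_) (++-assoc B C D) ⟨
    A ++ ((B ++ C) ++ D)  ≈⟨ ≋-++ (≋-refl {A}) (≋-++ (++-comm-≋ B C) (≋-refl {D})) ⟩
    A ++ ((C ++ B) ++ D)  ≡⟨ cong (A ++_) (++-assoc C B D) ⟩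
    A ++ (C ++ (B ++ D))  ≡⟨ ++-assoc A C (B ++ D) ⟨
    (A ++ C) ++ (B ++ D)  ∎
  where open ≋-Reasoning

concatMap-≋ : ∀ {X : Set} {f g : X → List ℕ} → (∀ i → f i ≋ g i) → ∀ I → concatMap f I ≋ concatMap g I
concatMap-≋ f≋g [] = ≋-refl
concatMap-≋ f≋g (i ∷ I) = ≋-++ (f≋g i) (concatMap-≋ f≋g I)

concatMap-++-≋ : ∀ {X : Set} (f g : X → List ℕ) I →
  concatMap (λ i → f i ++ g i) I ≋ concatMap f I ++ concatMap g I
concatMap-++-≋ f g [] = ≋-refl
concatMap-++-≋ f g (i ∷ I) = begin
    (f i ++ g i) ++ concatMap (λ i → f i ++ g i) I
      ≈⟨ ≋-++ (≋-refl {f i ++ g i}) (concatMap-++-≋ f g I) ⟩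
    (f i ++ g i) ++ (concatMap f I ++ concatMap g I)
      ≈⟨ ++-interchange-≋ (f i) (g i) _ _ ⟩
    (f i ++ concatMap f I) ++ (g i ++ concatMap g I) ∎
  where open ≋-Reasoning

concatMap-[] : ∀ {X : Set} (I : List X) → concatMap (λ _ → [] {A = ℕ}) I ≡ []
concatMap-[] [] = refl
concatMap-[] (_ ∷ I) = concatMap-[] I

concatMap-comm : ∀ {X Y : Set} (P : X → Y → List ℕ) I J →
  concatMap (λ j → concatMap (λ i → P i j) I) J ≋ concatMap (λ i → concatMap (λ j → P i j) J) I
concatMap-comm P I [] = ≋-reflexive (sym (concatMap-[] I))
concatMap-comm P I (j ∷ J) = begin
    concatMap (λ i → P i j) I ++ concatMap (λ j → concatMap (λ i → P i j) I) J
      ≈⟨ ≋-++ (≋-refl {concatMap (λ i → P i j) I}) (concatMap-comm P I J) ⟩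
    concatMap (λ i → P i j) I ++ concatMap (λ i → concatMap (λ j → P i j) J) I
      ≈⟨ ≋-sym (concatMap-++-≋ (λ i → P i j) (λ i → concatMap (λ j → P i j) J) I) ⟩
    concatMap (λ i → P i j ++ concatMap (λ j → P i j) J) I ∎
  where open ≋-Reasoning

concatMap-[-] : ∀ {X : Set} (f : X → ℕ) L → concatMap (λ j → [ f j ]) L ≡ map f L
concatMap-[-] f [] = refl
concatMap-[-] f (j ∷ L) = cong (f j ∷_) (concatMap-[-] f L)

pairs-≋ : ∀ {X : Set} (f g : X → ℕ) L → concatMap (λ j → f j ∷ g j ∷ []) L ≋ map f L ++ map g L
pairs-≋ f g L = begin
    concatMap (λ j → [ f j ] ++ [ g j ]) L
      ≈⟨ concatMap-++-≋ (λ j → [ f j ]) (λ j → [ g j ]) L ⟩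
    concatMap (λ j → [ f j ]) L ++ concatMap (λ j → [ g j ]) L
      ≡⟨ cong₂ _++_ (concatMap-[-] f L) (concatMap-[-] g L) ⟩
    map f L ++ map g L ∎
  where open ≋-Reasoning

pairs-flip-≋ : ∀ {X : Set} (f g : X → ℕ) L →
  concatMap (λ j → g j ∷ f j ∷ []) L ≋ concatMap (λ j → f j ∷ g j ∷ []) L
pairs-flip-≋ f g L = ≋-trans (pairs-≋ g f L)
  (≋-trans (++-comm-≋ (map g L) (map f L)) (≋-sym (pairs-≋ f g L)))

range : ℕ → ℕ → List ℕ
range a zero = []
range a (suc m) = a ∷ range (suc a) m

length-range : ∀ a m → length (range a m) ≡ m
length-range a zero = refl
length-range a (suc m) = cong suc (length-range (suc a) m)

range-++ : ∀ a b c → range a b ++ range (a + b) c ≡ range a (b + c)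
range-++ a zero c = cong (λ z → range z c) (+-identityʳ a)
range-++ a (suc b) c =
  cong (a ∷_) (trans (cong (λ z → range (suc a) b ++ range z c) (+-suc a b)) (range-++ (suc a) b c))

map-range-suc : ∀ {X : Set} (g : ℕ → X) a m → map g (range (suc a) m) ≡ map (g ∘ suc) (range a m)
map-range-suc g a zero = refl
map-range-suc g a (suc m) = cong (g (suc a) ∷_) (map-range-suc g (suc a) m)

map-+-range : ∀ c a m → map (c +_) (range a m) ≡ range (c + a) m
map-+-range c a zero = refl
map-+-range c a (suc m) =
  cong (c + a ∷_) (trans (map-+-range c (suc a) m) (cong (λ z → range z m) (+-suc c a)))

applyUpTo-range : ∀ {X : Set} (g : ℕ → X) m → applyUpTo g m ≡ map g (range 0 m)
applyUpTo-range g zero = refl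
applyUpTo-range g (suc m) =
  cong (g 0 ∷_) (trans (applyUpTo-range (g ∘ suc) m) (sym (map-range-suc g 0 m)))

map-from1 : ∀ {X : Set} (g : ℕ → X) m → map g (from1 m) ≡ map (g ∘ suc) (range 0 m)
map-from1 g m = begin
    map g (map suc (applyUpTo (λ j → j) m))  ≡⟨ cong (map g ∘ map suc) (applyUpTo-range (λ j → j) m) ⟩
    map g (map suc (map (λ j → j) (range 0 m)))  ≡⟨ cong (map g ∘ map suc) (map-id (range 0 m)) ⟩
    map g (map suc (range 0 m))  ≡⟨ map-∘ (range 0 m) ⟨
    map (g ∘ suc) (range 0 m)  ∎
  where open ≡-Reasoning

length-from1 : ∀ {X : Set} (g : ℕ → X) m → length (map g (from1 m)) ≡ m
length-from1 g m =
  trans (cong length (map-from1 g m)) (trans (length-map (g ∘ suc) (range 0 m)) (length-range 0 m))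

reverse-range : ∀ {c} e m → c ≡ e + m → map (λ j → c ∸ suc j) (range 0 m) ≋ range e m
reverse-range e m refl = descending m
  where
  descending : ∀ m → map (λ j → e + m ∸ suc j) (range 0 m) ≋ range e m
  descending zero = ≋-refl
  descending (suc m) = begin
      map (λ j → e + suc m ∸ suc j) (range 0 (suc m))
        ≡⟨ cong (λ c → map (λ j → c ∸ suc j) (range 0 (suc m))) (+-suc e m) ⟩
      e + m ∷ map (λ j → suc (e + m) ∸ suc j) (range 1 m)
        ≡⟨ cong (e + m ∷_) (map-range-suc (λ j → suc (e + m) ∸ suc j) 0 m) ⟩
      [ e + m ] ++ map (λ j → e + m ∸ suc j) (range 0 m)
        ≈⟨ ≋-++ (≋-refl {[ e + m ]}) (descending m) ⟩
      [ e + m ] ++ range e m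
        ≈⟨ ++-comm-≋ [ e + m ] (range e m) ⟩
      range e m ++ range (e + m) 1
        ≡⟨ range-++ e m 1 ⟩
      range e (m + 1)
        ≡⟨ cong (range e) (+-comm m 1) ⟩
      range e (suc m) ∎
    where open ≋-Reasoning

All-range : ∀ {X : Set} {P : X → Set} (G : ℕ → X) m →
  (∀ j → j < m → P (G j)) → All P (map G (range 0 m))
All-range G zero h = []
All-range {P = P} G (suc m) h = h 0 z<s ∷
  subst (All P) (sym (map-range-suc G 0 m)) (All-range (G ∘ suc) m (λ j j<m → h (suc j) (s≤s j<m)))

mult-range-below : ∀ x a m → x < a → mult x (range a m) ≡ 0
mult-range-below x a zero x<a = refl
mult-range-below x a (suc m) x<a with x ≟ a
... | yes refl = ⊥-elim (<-irrefl refl x<a)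
... | no _ = mult-range-below x (suc a) m (m<n⇒m<1+n x<a)

mult-range-≤1 : ∀ x a m → mult x (range a m) ≤ 1
mult-range-≤1 x a zero = z≤n
mult-range-≤1 x a (suc m) with x ≟ a
... | yes refl = s≤s (≤-reflexive (mult-range-below x (suc x) m ≤-refl))
... | no _ = mult-range-≤1 x (suc a) m

mult-range-inside : ∀ x a m → a ≤ x → x < a + m → 1 ≤ mult x (range a m)
mult-range-inside x a zero a≤x x<a+0 = ⊥-elim (<-irrefl refl (<-≤-trans x<a+0 (subst (_≤ x) (sym (+-identityʳ a)) a≤x)))
mult-range-inside x a (suc m) a≤x x<a+m with x ≟ a
... | yes _ = s≤s z≤n
... | no x≢a = mult-range-inside x (suc a) m (≤∧≢⇒< a≤x (x≢a ∘ sym)) (subst (x <_) (+-suc a m) x<a+m)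

mult-range-support : ∀ x a m → 1 ≤ mult x (range a m) → a ≤ x × x < a + m
mult-range-support x a zero ()
mult-range-support x a (suc m) p with x ≟ a
... | yes refl = ≤-refl , subst (x <_) (sym (+-suc x m)) (s≤s (m≤m+n x m))
... | no _ with mult-range-support x (suc a) m p
...   | a<x , x<a+m = <⇒≤ a<x , subst (x <_) (sym (+-suc a m)) x<a+m

∈⇒mult : ∀ {x L} → x ∈ L → 1 ≤ mult x L
∈⇒mult {x} {y ∷ L} x∈L with x ≟ y | x∈L
... | yes _ | _ = s≤s z≤n
... | no x≢y | here x≡y = ⊥-elim (x≢y x≡y)
... | no _ | there x∈L′ = ∈⇒mult x∈L′

mult⇒∈ : ∀ x L → 1 ≤ mult x L → x ∈ L
mult⇒∈ x (y ∷ L) p with x ≟ y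
... | yes x≡y = here x≡y
... | no _ = there (mult⇒∈ x L p)

mult-tail : ∀ x y L → mult x L ≤ mult x (y ∷ L)
mult-tail x y L with x ≟ y
... | yes _ = n≤1+n _
... | no _ = ≤-refl

mult-head : ∀ y L → mult y (y ∷ L) ≡ suc (mult y L)
mult-head y L with y ≟ y
... | yes _ = refl
... | no y≢y = ⊥-elim (y≢y refl)

mult≤1⇒Unique : ∀ L → (∀ x → mult x L ≤ 1) → Unique L
mult≤1⇒Unique [] _ = []
mult≤1⇒Unique (y ∷ L) once = ¬Any⇒All¬ L y∉L ∷ mult≤1⇒Unique L (λ x → ≤-trans (mult-tail x y L) (once x))
  where
  y∉L : y ∉ L
  y∉L y∈L = <-irrefl refl (≤-trans (s≤s (∈⇒mult y∈L)) (subst (_≤ 1) (mult-head y L) (once y)))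

mult-lookup : ∀ x (Ts : List (List ℕ)) i → mult x (lookup Ts i) ≤ mult x (concat Ts)
mult-lookup x (T ∷ Ts) fzero = ≤-trans (m≤m+n _ _) (≤-reflexive (sym (mult-++ x T (concat Ts))))
mult-lookup x (T ∷ Ts) (fsuc i) =
  ≤-trans (mult-lookup x Ts i) (≤-trans (m≤n+m _ _) (≤-reflexive (sym (mult-++ x T (concat Ts)))))

mult-lookup₂ : ∀ x (Ts : List (List ℕ)) i j → i ≢ j →
  mult x (lookup Ts i) + mult x (lookup Ts j) ≤ mult x (concat Ts)
mult-lookup₂ x (T ∷ Ts) fzero fzero i≢j = ⊥-elim (i≢j refl)
mult-lookup₂ x (T ∷ Ts) fzero (fsuc j) _ =
  ≤-trans (+-monoʳ-≤ (mult x T) (mult-lookup x Ts j)) (≤-reflexive (sym (mult-++ x T (concat Ts))))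
mult-lookup₂ x (T ∷ Ts) (fsuc i) fzero _ =
  ≤-trans (≤-reflexive (+-comm (mult x (lookup Ts i)) (mult x T)))
    (≤-trans (+-monoʳ-≤ (mult x T) (mult-lookup x Ts i)) (≤-reflexive (sym (mult-++ x T (concat Ts)))))
mult-lookup₂ x (T ∷ Ts) (fsuc i) (fsuc j) i≢j =
  ≤-trans (mult-lookup₂ x Ts i j (i≢j ∘ cong fsuc))
    (≤-trans (m≤n+m _ _) (≤-reflexive (sym (mult-++ x T (concat Ts)))))

record Family (Ts : List (List ℕ)) (m s : ℕ) (C : List ℕ) : Set where
  constructor family
  field
    size    : length Ts ≡ m
    sums    : All (λ T → sum T ≡ s) Ts
    content : concat Ts ≋ C

Family-resp : ∀ {Ts m m′ s s′ C C′} → m ≡ m′ → s ≡ s′ → C ≋ C′ →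
  Family Ts m s C → Family Ts m′ s′ C′
Family-resp refl refl C≋C′ (family size sums content) = family size sums (≋-trans content C≋C′)

Family⇒partition : ∀ {n k t Ts} → Family Ts k t (range 1 n) → IsKTPartition n k t Ts
Family⇒partition {n} {k} {t} {Ts} (family size sums content) = record
  { count = size
  ; areSets = λ i → mult≤1⇒Unique (lookup Ts i) (λ x → ≤-trans (mult-lookup x Ts i) (once x))
  ; disjoint = λ i j i≢j x x∈Tᵢ x∈Tⱼ → <-irrefl refl
      (≤-trans (+-mono-≤ (∈⇒mult x∈Tᵢ) (∈⇒mult x∈Tⱼ)) (≤-trans (mult-lookup₂ x Ts i j i≢j) (once x)))
  ; covers = λ x (1≤x , x≤n) →
      let x∈concat = mult⇒∈ x (concat Ts)
                       (subst (1 ≤_) (sym (mult-≡ content x)) (mult-range-inside x 1 n 1≤x (s≤s x≤n)))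
          x∈some = ∈-concat⁻ Ts x∈concat
      in index x∈some , lookup-index x∈some
  ; within = λ i x x∈Tᵢ →
      let (1≤x , x<1+n) = mult-range-support x 1 n
                            (subst (1 ≤_) (mult-≡ content x) (≤-trans (∈⇒mult x∈Tᵢ) (mult-lookup x Ts i)))
      in 1≤x , ≤-pred x<1+n
  ; sums = λ i → All.lookup sums (∈-lookup i)
  }
  where
  once : ∀ x → mult x (concat Ts) ≤ 1
  once x = subst (_≤ 1) (sym (mult-≡ content x)) (mult-range-≤1 x 1 n)

Family-++ : ∀ {A B m m′ s C D} → Family A m s C → Family B m′ s D → Family (A ++ B) (m + m′) s (C ++ D)
Family-++ {A} {B} (family sizeA sumsA contentA) (family sizeB sumsB contentB) = family
  (trans (length-++ A) (cong₂ _+_ sizeA sizeB))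
  (++⁺ sumsA sumsB)
  (≋-trans (≋-reflexive (sym (concat-++ A B))) (≋-++ contentA contentB))

Family-zip : ∀ {A B m s s′ C D} → Family A m s C → Family B m s′ D →
  Family (zipWith _++_ A B) m (s + s′) (C ++ D)
Family-zip {A} {B} {m} (family sizeA sumsA contentA) (family sizeB sumsB contentB) = family
  (trans (length-zipWith _++_ A B) (trans (cong₂ _⊓_ sizeA sizeB) (⊓-idem m)))
  (zip-sums A B sumsA sumsB)
  (≋-trans (zip-content A B (trans sizeA (sym sizeB))) (≋-++ contentA contentB))
  where
  zip-sums : ∀ {s s′} A B → All (λ T → sum T ≡ s) A → All (λ T → sum T ≡ s′) B →
    All (λ T → sum T ≡ s + s′) (zipWith _++_ A B)
  zip-sums [] _ _ _ = []
  zip-sums (_ ∷ _) [] _ _ = []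
  zip-sums (T ∷ A) (U ∷ B) (sumT ∷ sumsA) (sumU ∷ sumsB) =
    trans (sum-++ T U) (cong₂ _+_ sumT sumU) ∷ zip-sums A B sumsA sumsB
  zip-content : ∀ A B → length A ≡ length B → concat (zipWith _++_ A B) ≋ concat A ++ concat B
  zip-content [] [] _ = ≋-refl
  zip-content (T ∷ A) (U ∷ B) eq = ≋-trans (≋-++ (≋-refl {T ++ U}) (zip-content A B (suc-injective eq)))
                                           (++-interchange-≋ T U (concat A) (concat B))

Family-pairUp : ∀ {L} c {h C} → Family L (c + c) h C → Family (pairUp L) c (h + h) C
Family-pairUp {L} c {h} (family size sums content) =
  let (size′ , sums′) = halve L c size sums
  in family size′ sums′ (≋-trans (≋-reflexive (pairUp-concat L)) content)
  where
  halve : ∀ L c → length L ≡ c + c → All (λ T → sum T ≡ h) L →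
    length (pairUp L) ≡ c × All (λ T → sum T ≡ h + h) (pairUp L)
  halve [] zero _ _ = refl , []
  halve (_ ∷ []) (suc c) eq _ = ⊥-elim (0≢1+n (trans (suc-injective eq) (+-suc c c)))
  halve (T ∷ U ∷ L) (suc c) eq (sumT ∷ sumU ∷ sums)
    with halve L c (suc-injective (trans (suc-injective eq) (+-suc c c))) sums
  ... | size′ , sums′ = cong suc size′ , trans (sum-++ T U) (cong₂ _+_ sumT sumU) ∷ sums′
  pairUp-concat : ∀ L → concat (pairUp L) ≡ concat L
  pairUp-concat (T ∷ U ∷ L) = trans (++-assoc T U _) (cong ((T ++_) ∘ (U ++_)) (pairUp-concat L))
  pairUp-concat (T ∷ []) = refl
  pairUp-concat [] = refl

pairList : ℕ → ℕ → ℕ → List (List ℕ)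
pairList a c m = map (λ j → (a + j) ∷ (c ∸ suc j) ∷ []) (range 0 m)

pairList-content : ∀ a {c} e m → c ≡ e + m → concat (pairList a c m) ≋ range a m ++ range e m
pairList-content a {c} e m c≡e+m = begin
    concatMap (λ j → (a + j) ∷ (c ∸ suc j) ∷ []) (range 0 m)
      ≈⟨ pairs-≋ (a +_) (λ j → c ∸ suc j) (range 0 m) ⟩
    map (a +_) (range 0 m) ++ map (λ j → c ∸ suc j) (range 0 m)
      ≈⟨ ≋-++ (≋-reflexive (trans (map-+-range a 0 m) (cong (λ z → range z m) (+-identityʳ a))))
              (reverse-range e m c≡e+m) ⟩
    range a m ++ range e m ∎
  where open ≋-Reasoning

pairList-family : ∀ a b m → m ≤ suc b →
  Family (pairList a (suc b) m) m (a + b) (range a m ++ range (suc b ∸ m) m)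
pairList-family a b m m≤1+b = family
  (trans (length-map _ (range 0 m)) (length-range 0 m))
  (All-range _ m λ j j<m → pairSum j (≤-pred (≤-trans j<m m≤1+b)))
  (pairList-content a (suc b ∸ m) m (sym (m∸n+n≡m m≤1+b)))
  where
  pairSum : ∀ j → j ≤ b → (a + j) + ((b ∸ j) + 0) ≡ a + b
  pairSum j j≤b = trans (regroup a j (b ∸ j)) (cong (a +_) (m∸n+n≡m j≤b))
    where
    regroup : ∀ a j d → (a + j) + (d + 0) ≡ a + (d + j)
    regroup = solve-∀


meanderBlock : ∀ s k i → concat (pairList (s + 2 * k * i) (s + 2 * k * suc i) k) ≋ range (s + 2 * k * i) (2 * k)
meanderBlock s k i = begin
    concat (pairList (s + 2 * k * i) (s + 2 * k * suc i) k)
      ≈⟨ pairList-content (s + 2 * k * i) (s + 2 * k * i + k) k (blockEnd s k i) ⟩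
    range (s + 2 * k * i) k ++ range (s + 2 * k * i + k) k
      ≡⟨ range-++ (s + 2 * k * i) k k ⟩
    range (s + 2 * k * i) (k + k)
      ≡⟨ cong (λ z → range (s + 2 * k * i) (k + z)) (sym (+-identityʳ k)) ⟩
    range (s + 2 * k * i) (2 * k) ∎
  where
  open ≋-Reasoning
  blockEnd : ∀ s k i → s + 2 * k * suc i ≡ s + 2 * k * i + k + k
  blockEnd = solve-∀

concat-blocks : ∀ (B : ℕ → List ℕ) s w q → (∀ i → B i ≋ range (s + w * i) w) →
  concatMap B (range 0 q) ≋ range s (w * q)
concat-blocks B s w zero _ = ≋-reflexive (cong (range s) (sym (*-zeroʳ w)))
concat-blocks B s w (suc q) block = begin
    B 0 ++ concat (map B (range 1 q))
      ≡⟨ cong (λ z → B 0 ++ concat z) (map-range-suc B 0 q) ⟩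
    B 0 ++ concatMap (B ∘ suc) (range 0 q)
      ≈⟨ ≋-++ (block 0) (concat-blocks (B ∘ suc) (s + w) w q λ i →
                 ≋-trans (block (suc i)) (≋-reflexive (cong (λ z → range z w) (nextStart s w i)))) ⟩
    range (s + w * 0) w ++ range (s + w) (w * q)
      ≡⟨ cong (λ z → range z w ++ range (s + w) (w * q)) (trans (cong (s +_) (*-zeroʳ w)) (+-identityʳ s)) ⟩
    range s w ++ range (s + w) (w * q)
      ≡⟨ range-++ s w (w * q) ⟩
    range s (w + w * q)
      ≡⟨ cong (range s) (sym (*-suc w q)) ⟩
    range s (w * suc q) ∎
  where
  open ≋-Reasoning
  nextStart : ∀ s w i → s + w * suc i ≡ s + w + w * i
  nextStart = solve-∀

concatMap-from1 : ∀ {X : Set} (g : ℕ → List X) m → concatMap g (from1 m) ≡ concatMap (g ∘ suc) (range 0 m)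
concatMap-from1 g m = cong concat (map-from1 g m)

meanderContent : ∀ s k q (P : ℕ → ℕ → List ℕ) →
  (∀ i j → P (suc i) (suc j) ≡ (s + 2 * k * suc i ∸ suc j) ∷ (s + 2 * k * i + j) ∷ []) →
  concatMap (λ j → concatMap (λ i → P i j) (from1 q)) (from1 k) ≋ range s (2 * k * q)
meanderContent s k q P shape = begin
    concatMap (λ j → concatMap (λ i → P i j) (from1 q)) (from1 k)
      ≈⟨ concatMap-comm P (from1 q) (from1 k) ⟩
    concatMap (λ i → concatMap (P i) (from1 k)) (from1 q)
      ≡⟨ concatMap-from1 (λ i → concatMap (P i) (from1 k)) q ⟩
    concatMap (λ i → concatMap (P (suc i)) (from1 k)) (range 0 q)
      ≡⟨ concatMap-cong (λ i → trans (concatMap-from1 (P (suc i)) k) (concatMap-cong (shape i) (range 0 k)))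
                        (range 0 q) ⟩
    concatMap (λ i → concatMap (λ j → (c i ∸ suc j) ∷ (a i + j) ∷ []) (range 0 k)) (range 0 q)
      ≈⟨ concatMap-≋ (λ i → pairs-flip-≋ (a i +_) (λ j → c i ∸ suc j) (range 0 k)) (range 0 q) ⟩
    concatMap (λ i → concat (pairList (a i) (c i) k)) (range 0 q)
      ≈⟨ concat-blocks _ s (2 * k) q (meanderBlock s k) ⟩
    range s (2 * k * q) ∎
  where
  open ≋-Reasoning
  a c : ℕ → ℕ
  a i = s + 2 * k * i
  c i = s + 2 * k * suc i

nonzero? : (x : ℕ) → Dec (x ≢ 0)
nonzero? x = ¬? (x ≟ 0)

mult-filter-zero : ∀ A → mult 0 (filter nonzero? A) ≡ 0
mult-filter-zero [] = refl
mult-filter-zero (zero ∷ A) = mult-filter-zero A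
mult-filter-zero (suc _ ∷ A) = mult-filter-zero A

mult-filter-suc : ∀ x A → mult (suc x) (filter nonzero? A) ≡ mult (suc x) A
mult-filter-suc x [] = refl
mult-filter-suc x (zero ∷ A) = mult-filter-suc x A
mult-filter-suc x (suc y ∷ A) with suc x ≟ suc y
... | yes _ = cong suc (mult-filter-suc x A)
... | no _ = mult-filter-suc x A

filter-nonzero-range : ∀ {A} n → A ≋ range 0 (suc n) → filter nonzero? A ≋ range 1 n
filter-nonzero-range {A} n A≋ = ≋-by λ where
  zero → trans (mult-filter-zero A) (sym (mult-range-below 0 1 n z<s))
  (suc x) → trans (mult-filter-suc x A) (mult-≡ A≋ (suc x))

concatMap-filter : ∀ {X : Set} (G : X → List ℕ) J →
  concatMap (λ j → filter nonzero? (G j)) J ≡ filter nonzero? (concatMap G J)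
concatMap-filter G [] = refl
concatMap-filter G (j ∷ J) =
  trans (cong (filter nonzero? (G j) ++_) (concatMap-filter G J)) (sym (filter-++ nonzero? (G j) (concatMap G J)))

sum-pairs : ∀ {X : Set} (f g : X → ℕ) L →
  sum (concatMap (λ i → f i ∷ g i ∷ []) L) ≡ sum (map (λ i → f i + g i) L)
sum-pairs f g [] = refl
sum-pairs f g (i ∷ L) = trans (sym (+-assoc (f i) (g i) _)) (cong (f i + g i +_) (sum-pairs f g L))

sum-map-+1 : ∀ (f : ℕ → ℕ) a m → sum (map (λ i → f i + 1) (range a m)) ≡ sum (map f (range a m)) + m
sum-map-+1 f a zero = refl
sum-map-+1 f a (suc m) =
  trans (cong (f a + 1 +_) (sum-map-+1 f (suc a) m)) (regroup (f a) (sum (map f (range (suc a) m))) m)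
  where
  regroup : ∀ x y m → x + 1 + (y + m) ≡ x + y + suc m
  regroup = solve-∀

sum-filter-nonzero : ∀ L → sum (filter nonzero? L) ≡ sum L
sum-filter-nonzero [] = refl
sum-filter-nonzero (zero ∷ L) = sum-filter-nonzero L
sum-filter-nonzero (suc x ∷ L) = cong (suc x +_) (sum-filter-nonzero L)

sum-odd-multiples : ∀ A B q → sum (map (λ i → A * suc i + A * i + B) (range 0 q)) ≡ A * q * q + B * q
sum-odd-multiples A B zero = empty A B
  where
  empty : ∀ A B → 0 ≡ A * 0 * 0 + B * 0
  empty = solve-∀
sum-odd-multiples A B (suc q) = begin
    f 0 + sum (map f (range 1 q))
      ≡⟨ cong (λ z → f 0 + sum z) (map-range-suc f 0 q) ⟩
    f 0 + sum (map (f ∘ suc) (range 0 q))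
      ≡⟨ cong (λ z → f 0 + sum z) (map-cong (shift A B) (range 0 q)) ⟩
    f 0 + sum (map (λ i → A * suc i + A * i + (B + 2 * A)) (range 0 q))
      ≡⟨ cong (f 0 +_) (sum-odd-multiples A (B + 2 * A) q) ⟩
    f 0 + (A * q * q + (B + 2 * A) * q)
      ≡⟨ square A B q ⟩
    A * suc q * suc q + B * suc q ∎
  where
  open ≡-Reasoning
  f : ℕ → ℕ
  f i = A * suc i + A * i + B
  shift : ∀ A B i → A * suc (suc i) + A * suc i + B ≡ A * suc i + A * i + (B + 2 * A)
  shift = solve-∀
  square : ∀ A B q → A * 1 + A * 0 + B + (A * q * q + (B + 2 * A) * q) ≡ A * suc q * suc q + B * suc q
  square = solve-∀

∸-pair : ∀ c d j → j ≤ c → (c ∸ j) + (d + j) ≡ c + d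
∸-pair c d j j≤c = trans (regroup (c ∸ j) d j) (cong (_+ d) (m∸n+n≡m j≤c))
  where
  regroup : ∀ x d j → x + (d + j) ≡ x + j + d
  regroup = solve-∀

All-from1 : ∀ {X : Set} {P : X → Set} (G : ℕ → X) m →
  (∀ j → j < m → P (G (suc j))) → All P (map G (from1 m))
All-from1 {P = P} G m h = subst (All P) (sym (map-from1 G m)) (All-range (G ∘ suc) m h)

cancel-2k : ∀ k {x y} → 2 * (suc k * x) ≡ 2 * (suc k * y) → x ≡ y
cancel-2k k eq = *-cancelˡ-≡ _ _ (suc k) (*-cancelˡ-≡ _ _ 2 eq)

-- j < k ≤ 2k(i+1): the descending entries of a meander never underflow.
<-2k[1+i] : ∀ {j} k i → j < k → j < 2 * k * suc i
<-2k[1+i] k i j<k = <-≤-trans j<k (subst (k ≤_) (sym (expand k i)) (m≤m+n k _))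
  where
  expand : ∀ k i → 2 * k * suc i ≡ k + (k + 2 * k * i)
  expand = solve-∀

meanderEven-sums : ∀ k q t → q * (2 * k) * (q * (2 * k) + 1) ≡ 2 * (k * t) →
  All (λ T → sum T ≡ t) (meanderEven k q)
meanderEven-sums zero q t _ = []
meanderEven-sums k@(suc k₀) q t balanced = All-from1 _ k λ j j<k → begin
    sum (concatMap (λ i → (2 * k * i ∸ j) ∷ (2 * k * (i ∸ 1) + suc j) ∷ []) (from1 q))
      ≡⟨ sum-pairs _ _ (from1 q) ⟩
    sum (map (λ i → (2 * k * i ∸ j) + (2 * k * (i ∸ 1) + suc j)) (from1 q))
      ≡⟨ cong sum (map-from1 _ q) ⟩
    sum (map (λ i → (2 * k * suc i ∸ j) + (2 * k * i + suc j)) (range 0 q))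
      ≡⟨ cong sum (map-cong (λ i → pairSum i j (<⇒≤ (<-2k[1+i] k i j<k))) (range 0 q)) ⟩
    sum (map (λ i → 2 * k * suc i + 2 * k * i + 1) (range 0 q))
      ≡⟨ sum-odd-multiples (2 * k) 1 q ⟩
    2 * k * q * q + 1 * q
      ≡⟨ cancel-2k k₀ (trans (sym balanced) (tOf k q)) ⟨
    t ∎
  where
  open ≡-Reasoning
  pairSum : ∀ i j → j ≤ 2 * k * suc i → (2 * k * suc i ∸ j) + (2 * k * i + suc j) ≡ 2 * k * suc i + 2 * k * i + 1
  pairSum i j j≤c = trans (regroup (2 * k * suc i ∸ j) (2 * k * i) j) (cong (_+ 1) (∸-pair _ _ j j≤c))
    where
    regroup : ∀ x d j → x + (d + suc j) ≡ x + (d + j) + 1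
    regroup = solve-∀
  tOf : ∀ k q → q * (2 * k) * (q * (2 * k) + 1) ≡ 2 * (k * (2 * k * q * q + 1 * q))
  tOf = solve-∀

meanderEven-family : ∀ n k q t → n ≡ q * (2 * k) → n * (n + 1) ≡ 2 * (k * t) →
  Family (meanderEven k q) k t (range 1 n)
meanderEven-family n k q t refl balanced = family
  (length-from1 _ k)
  (meanderEven-sums k q t balanced)
  (≋-trans (meanderContent 1 k q (λ i j → (2 * k * i ∸ (j ∸ 1)) ∷ (2 * k * (i ∸ 1) + j) ∷ [])
                             (λ i j → cong (λ x → (2 * k * suc i ∸ j) ∷ x ∷ []) (+-suc (2 * k * i) j)))
           (≋-reflexive (cong (range 1) (*-comm (2 * k) q))))

meanderOdd-sums : ∀ n k q t → n + 1 ≡ q * (2 * k) → n * (n + 1) ≡ 2 * (k * t) →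
  All (λ T → sum T ≡ t) (meanderOdd k q)
meanderOdd-sums n zero q t _ _ = []
meanderOdd-sums n k@(suc k₀) q t n+1≡q·2k balanced = All-from1 _ k λ j j<k → +-cancelʳ-≡ q _ _ (begin
    sum (filter nonzero? (concatMap (λ i → (2 * k * i ∸ suc j) ∷ (2 * k * (i ∸ 1) + j) ∷ []) (from1 q))) + q
      ≡⟨ cong (_+ q) (sum-filter-nonzero (concatMap (λ i → (2 * k * i ∸ suc j) ∷ (2 * k * (i ∸ 1) + j) ∷ []) (from1 q))) ⟩
    sum (concatMap (λ i → (2 * k * i ∸ suc j) ∷ (2 * k * (i ∸ 1) + j) ∷ []) (from1 q)) + q
      ≡⟨ cong (_+ q) (trans (sum-pairs _ _ (from1 q)) (cong sum (map-from1 _ q))) ⟩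
    sum (map (λ i → (2 * k * suc i ∸ suc j) + (2 * k * i + j)) (range 0 q)) + q
      ≡⟨ sum-map-+1 _ 0 q ⟨
    sum (map (λ i → (2 * k * suc i ∸ suc j) + (2 * k * i + j) + 1) (range 0 q))
      ≡⟨ cong sum (map-cong (λ i → pairSum i j (<-2k[1+i] k i j<k)) (range 0 q)) ⟩
    sum (map (λ i → 2 * k * suc i + 2 * k * i + 0) (range 0 q))
      ≡⟨ sum-odd-multiples (2 * k) 0 q ⟩
    2 * k * q * q + 0 * q
      ≡⟨ t+q ⟨
    t + q ∎)
  where
  open ≡-Reasoning
  pairSum : ∀ i j → suc j ≤ 2 * k * suc i →
    (2 * k * suc i ∸ suc j) + (2 * k * i + j) + 1 ≡ 2 * k * suc i + 2 * k * i + 0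
  pairSum i j 1+j≤c = trans (regroup (2 * k * suc i ∸ suc j) (2 * k * i) j) (cong (_+ 0) (∸-pair _ _ (suc j) 1+j≤c))
    where
    regroup : ∀ x d j → x + (d + j) + 1 ≡ x + (d + suc j) + 0
    regroup = solve-∀
  t≡nq : t ≡ n * q
  t≡nq = cancel-2k k₀ (trans (sym balanced) (trans (cong (n *_) n+1≡q·2k) (rearrange k n q)))
    where
    rearrange : ∀ k n q → n * (q * (2 * k)) ≡ 2 * (k * (n * q))
    rearrange = solve-∀
  t+q : t + q ≡ 2 * k * q * q + 0 * q
  t+q = begin
    t + q             ≡⟨ cong (_+ q) t≡nq ⟩
    n * q + q         ≡⟨ trans (*-distribʳ-+ q n 1) (cong (n * q +_) (*-identityˡ q)) ⟨
    (n + 1) * q       ≡⟨ cong (_* q) n+1≡q·2k ⟩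
    q * (2 * k) * q   ≡⟨ rearrange k q ⟩
    2 * k * q * q + 0 * q ∎
    where
    rearrange : ∀ k q → q * (2 * k) * q ≡ 2 * k * q * q + 0 * q
    rearrange = solve-∀

meanderOdd-family : ∀ n k q t → n + 1 ≡ q * (2 * k) → n * (n + 1) ≡ 2 * (k * t) →
  Family (meanderOdd k q) k t (range 1 n)
meanderOdd-family n k q t n+1≡q·2k balanced =
  family (length-from1 _ k) (meanderOdd-sums n k q t n+1≡q·2k balanced) content
  where
  P : ℕ → ℕ → List ℕ
  P i j = (2 * k * i ∸ j) ∷ (2 * k * (i ∸ 1) + (j ∸ 1)) ∷ []
  content : concat (meanderOdd k q) ≋ range 1 n
  content = begin
      concatMap (λ j → filter nonzero? (concatMap (λ i → P i j) (from1 q))) (from1 k)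
        ≡⟨ concatMap-filter (λ j → concatMap (λ i → P i j) (from1 q)) (from1 k) ⟩
      filter nonzero? (concatMap (λ j → concatMap (λ i → P i j) (from1 q)) (from1 k))
        ≈⟨ filter-nonzero-range n (≋-trans (meanderContent 0 k q P (λ _ _ → refl))
                                            (≋-reflexive (cong (range 0) 2kq≡1+n))) ⟩
      range 1 n ∎
    where
    open ≋-Reasoning
    2kq≡1+n : 2 * k * q ≡ suc n
    2kq≡1+n = trans (*-comm (2 * k) q) (trans (sym n+1≡q·2k) (+-comm n 1))

-- The invariant of the recursion of ΠSolve: t ≥ n and Δ_n = k·t (stated for 2Δ_n).
record Admissible (n k t : ℕ) : Set where
  constructor admissible
  field
    n≤t      : n ≤ t
    balanced : n * (n + 1) ≡ 2 * (k * t)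

record Reduction (n k t n′ k′ t′ : ℕ) (build : List (List ℕ) → List (List ℕ)) : Set where
  field
    smaller     : n′ < n
    admissible′ : Admissible n′ k′ t′
    lift        : ∀ {R} → Family R k′ t′ (range 1 n′) → Family (build R) k t (range 1 n)

Reduction-resp : ∀ {n k t n′ k′ t′ n″ k″ t″ build} → n′ ≡ n″ → k′ ≡ k″ → t′ ≡ t″ →
  Reduction n k t n″ k″ t″ build → Reduction n k t n′ k′ t′ build
Reduction-resp refl refl refl red = red

1≤n-of-∤ : ∀ {n} k → ¬ (2 * k ∣ n) → 1 ≤ n
1≤n-of-∤ {zero} k 2k∤0 = ⊥-elim (2k∤0 ((2 * k) ∣0))
1≤n-of-∤ {suc n} _ _ = s≤s z≤n

1≤k-of-balance : ∀ {n k t} → 1 ≤ n → n * (n + 1) ≡ 2 * (k * t) → 1 ≤ k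
1≤k-of-balance {suc n} {zero} _ ()
1≤k-of-balance {k = suc k} _ _ = s≤s z≤n

caseIIPairs : ℕ → ℕ → List (List ℕ)
caseIIPairs n k = map (λ j → (n ∸ 2 * k + j) ∷ (n ∸ (j ∸ 1)) ∷ []) (from1 k)

caseIIPairs-≡ : ∀ n k → caseIIPairs n k ≡ pairList (suc (n ∸ 2 * k)) (suc n) k
caseIIPairs-≡ n k =
  trans (map-from1 _ k) (map-cong (λ j → cong (_∷ (n ∸ j) ∷ []) (+-suc (n ∸ 2 * k) j)) (range 0 k))

caseII-core : ∀ d k u → 1 ≤ k → Admissible d k u →
  Reduction (2 * k + d) k (suc d + (2 * k + d) + u) d k u (zipWith _++_ (caseIIPairs (2 * k + d) k))
caseII-core d k u 1≤k adm = record
  { smaller = subst (d <_) (+-comm d (2 * k)) (m<m+n d (≤-trans 1≤k (m≤m+n k (k + 0))))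
  ; admissible′ = adm
  ; lift = λ famR → Family-resp refl sumEq contentEq (Family-zip pairsFamily famR)
  }
  where
  n : ℕ
  n = 2 * k + d
  pairsFamily : Family (caseIIPairs n k) k (suc (n ∸ 2 * k) + n) (range (suc (n ∸ 2 * k)) k ++ range (suc n ∸ k) k)
  pairsFamily = subst (λ Ts → Family Ts k (suc (n ∸ 2 * k) + n) (range (suc (n ∸ 2 * k)) k ++ range (suc n ∸ k) k))
                      (sym (caseIIPairs-≡ n k))
                      (pairList-family (suc (n ∸ 2 * k)) n k (m≤n⇒m≤1+n (≤-trans (m≤m+n k (k + 0)) (m≤m+n (2 * k) d))))
  n∸2k≡d : n ∸ 2 * k ≡ d
  n∸2k≡d = m+n∸m≡n (2 * k) d
  sumEq : suc (n ∸ 2 * k) + n + u ≡ suc d + n + u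
  sumEq = cong (λ x → suc x + n + u) n∸2k≡d
  upperStart : suc n ∸ k ≡ suc d + k
  upperStart = trans (cong (_∸ k) (regroup k d)) (m+n∸m≡n k (suc d + k))
    where
    regroup : ∀ k d → suc (2 * k + d) ≡ k + (suc d + k)
    regroup = solve-∀
  contentEq : (range (suc (n ∸ 2 * k)) k ++ range (suc n ∸ k) k) ++ range 1 d ≋ range 1 n
  contentEq = begin
      (range (suc (n ∸ 2 * k)) k ++ range (suc n ∸ k) k) ++ range 1 d
        ≡⟨ cong₂ (λ a b → (range a k ++ range b k) ++ range 1 d) (cong suc n∸2k≡d) upperStart ⟩
      (range (1 + d) k ++ range (1 + d + k) k) ++ range 1 d
        ≈⟨ ++-comm-≋ (range (1 + d) k ++ range (1 + d + k) k) (range 1 d) ⟩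
      range 1 d ++ (range (1 + d) k ++ range (1 + d + k) k)
        ≡⟨ cong (range 1 d ++_) (range-++ (1 + d) k k) ⟩
      range 1 d ++ range (1 + d) (k + k)
        ≡⟨ range-++ 1 d (k + k) ⟩
      range 1 (d + (k + k))
        ≡⟨ cong (range 1) (regroup k d) ⟩
      range 1 (2 * k + d) ∎
    where
    open ≋-Reasoning
    regroup : ∀ k d → d + (k + k) ≡ 2 * k + d
    regroup = solve-∀

-- 4k·n = 2k·2n ≤ 2k·t = n(n+1), hence 4k ≤ n + 1.
quarter-bound : ∀ {n k t} → 1 ≤ n → 2 * n ≤ t → n * (n + 1) ≡ 2 * (k * t) → 4 * k ≤ n + 1
quarter-bound {n} {k} {t} 1≤n 2n≤t balanced = *-cancelʳ-≤ (4 * k) (n + 1) n {{>-nonZero 1≤n}} (begin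
    4 * k * n        ≡⟨ regroup k n ⟩
    2 * k * (2 * n)  ≤⟨ *-monoʳ-≤ (2 * k) 2n≤t ⟩
    2 * k * t        ≡⟨ *-assoc 2 k t ⟩
    2 * (k * t)      ≡⟨ balanced ⟨
    n * (n + 1)      ≡⟨ *-comm n (n + 1) ⟩
    (n + 1) * n      ∎)
  where
  open ≤-Reasoning
  regroup : ∀ k n → 4 * k * n ≡ 2 * k * (2 * n)
  regroup = solve-∀

1≤2k : ∀ {k} → 1 ≤ k → 1 ≤ 2 * k
1≤2k {k} 1≤k = ≤-trans 1≤k (m≤m+n k (k + 0))

caseII-decompose : ∀ {n k t} → Admissible n k t → ¬ (2 * k ∣ n) → 2 * n ≤ t →
  ∃₂ λ d u → n ≡ 2 * k + d × t ≡ suc d + n + u × 1 ≤ k × 4 * k ≤ n + 1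
caseII-decompose {n} {k} {t} (admissible _ balanced) 2k∤n 2n≤t =
  n ∸ 2 * k , t ∸ (suc (n ∸ 2 * k) + n) , sym (m+[n∸m]≡n 2k≤n) , sym (m+[n∸m]≡n t-bound) , 1≤k , 4k≤n+1
  where
  open ≤-Reasoning
  1≤n : 1 ≤ n
  1≤n = 1≤n-of-∤ k 2k∤n
  1≤k : 1 ≤ k
  1≤k = 1≤k-of-balance 1≤n balanced
  4k≤n+1 : 4 * k ≤ n + 1
  4k≤n+1 = quarter-bound {k = k} 1≤n 2n≤t balanced
  2k≤n : 2 * k ≤ n
  2k≤n = +-cancelʳ-≤ 1 (2 * k) n (begin
    2 * k + 1      ≤⟨ +-monoʳ-≤ (2 * k) (1≤2k 1≤k) ⟩
    2 * k + 2 * k  ≡⟨ double k ⟩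
    4 * k          ≤⟨ 4k≤n+1 ⟩
    n + 1          ∎)
    where
    double : ∀ k → 2 * k + 2 * k ≡ 4 * k
    double = solve-∀
  t-bound : suc (n ∸ 2 * k) + n ≤ t
  t-bound = begin
    suc (n ∸ 2 * k) + n      ≤⟨ +-monoˡ-≤ n (+-monoˡ-≤ (n ∸ 2 * k) (1≤2k 1≤k)) ⟩
    2 * k + (n ∸ 2 * k) + n  ≡⟨ cong (_+ n) (m+[n∸m]≡n 2k≤n) ⟩
    n + n                    ≡⟨ cong (n +_) (+-identityʳ n) ⟨
    2 * n                    ≤⟨ 2n≤t ⟩
    t                        ∎

caseII-balance : ∀ k d u → (2 * k + d) * (2 * k + d + 1) ≡ 2 * (k * (suc d + (2 * k + d) + u)) →
  d * (d + 1) ≡ 2 * (k * u)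
caseII-balance k d u balanced =
  +-cancelˡ-≡ (2 * k * (2 * k + 2 * d + 1)) _ _ (trans (expandˡ k d) (trans balanced (expandʳ k d u)))
  where
  expandˡ : ∀ k d → 2 * k * (2 * k + 2 * d + 1) + d * (d + 1) ≡ (2 * k + d) * (2 * k + d + 1)
  expandˡ = solve-∀
  expandʳ : ∀ k d u → 2 * (k * (suc d + (2 * k + d) + u)) ≡ 2 * k * (2 * k + 2 * d + 1) + 2 * (k * u)
  expandʳ = solve-∀

balance⇒≤ : ∀ {k d u} → 1 ≤ k → 2 * k ≤ d + 1 → d * (d + 1) ≡ 2 * (k * u) → d ≤ u
balance⇒≤ {k} {d} {u} 1≤k 2k≤d+1 balanced = *-cancelʳ-≤ d u (2 * k) {{>-nonZero (1≤2k 1≤k)}} (begin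
    d * (2 * k)    ≤⟨ *-monoʳ-≤ d 2k≤d+1 ⟩
    d * (d + 1)    ≡⟨ balanced ⟩
    2 * (k * u)    ≡⟨ regroup k u ⟩
    u * (2 * k)    ∎)
  where
  open ≤-Reasoning
  regroup : ∀ k u → 2 * (k * u) ≡ u * (2 * k)
  regroup = solve-∀

caseII-t′ : ∀ k d u → suc d + (2 * k + d) + u ∸ 2 * (2 * k + d ∸ k) ∸ 1 ≡ u
caseII-t′ k d u = begin
    suc d + (2 * k + d) + u ∸ 2 * (2 * k + d ∸ k) ∸ 1
      ≡⟨ cong (λ x → suc d + (2 * k + d) + u ∸ 2 * x ∸ 1) (trans (cong (_∸ k) (regroup₁ k d)) (m+n∸m≡n k (k + d))) ⟩
    suc d + (2 * k + d) + u ∸ 2 * (k + d) ∸ 1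
      ≡⟨ ∸-+-assoc (suc d + (2 * k + d) + u) (2 * (k + d)) 1 ⟩
    suc d + (2 * k + d) + u ∸ (2 * (k + d) + 1)
      ≡⟨ cong (_∸ (2 * (k + d) + 1)) (regroup₂ k d u) ⟩
    2 * (k + d) + 1 + u ∸ (2 * (k + d) + 1)
      ≡⟨ m+n∸m≡n (2 * (k + d) + 1) u ⟩
    u ∎
  where
  open ≡-Reasoning
  regroup₁ : ∀ k d → 2 * k + d ≡ k + (k + d)
  regroup₁ = solve-∀
  regroup₂ : ∀ k d u → suc d + (2 * k + d) + u ≡ 2 * (k + d) + 1 + u
  regroup₂ = solve-∀

caseII-reduction : ∀ {n k t} → Admissible n k t → ¬ (2 * k ∣ n) → 2 * n ≤ t →
  Reduction n k t (n ∸ 2 * k) k (t ∸ 2 * (n ∸ k) ∸ 1) (zipWith _++_ (caseIIPairs n k))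
caseII-reduction {k = k} adm@(admissible _ balanced) 2k∤n 2n≤t with caseII-decompose adm 2k∤n 2n≤t
... | d , u , refl , refl , 1≤k , 4k≤n+1 =
  Reduction-resp (m+n∸m≡n (2 * k) d) refl (caseII-t′ k d u)
    (caseII-core d k u 1≤k (admissible (balance⇒≤ 1≤k 2k≤d+1 balanced′) balanced′))
  where
  balanced′ : d * (d + 1) ≡ 2 * (k * u)
  balanced′ = caseII-balance k d u balanced
  2k≤d+1 : 2 * k ≤ d + 1
  2k≤d+1 = +-cancelˡ-≤ (2 * k) (2 * k) (d + 1)
    (subst₂ _≤_ (regroup₁ k) (regroup₂ k d) 4k≤n+1)
    where
    regroup₁ : ∀ k → 4 * k ≡ 2 * k + 2 * k
    regroup₁ = solve-∀
    regroup₂ : ∀ k d → 2 * k + d + 1 ≡ 2 * k + (d + 1)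
    regroup₂ = solve-∀

pairSets-family : ∀ n t m → m ≤ n → n ≤ t → Family (pairSets n t m) m t (range (t ∸ n) m ++ range (suc n ∸ m) m)
pairSets-family n t m m≤n n≤t =
  subst (λ Ts → Family Ts m t (range (t ∸ n) m ++ range (suc n ∸ m) m)) (sym (map-from1 _ m))
    (Family-resp refl (m∸n+n≡m n≤t) ≋-refl (pairList-family (t ∸ n) n m (m≤n⇒m≤1+n m≤n)))

-- In cases III and IV t ≠ n, since t = n would give n(n+1) = 2kn, i.e. 2k ∣ n + 1.
n<t-of-∤ : ∀ {n k t} → 1 ≤ n → Admissible n k t → ¬ (2 * k ∣ n + 1) → n < t
n<t-of-∤ {n} {k} 1≤n (admissible n≤t balanced) 2k∤n+1 = ≤∧≢⇒< n≤t n≢t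
  where
  n≢t : n ≢ _
  n≢t refl = 2k∤n+1 (divides 1 (begin
    n + 1          ≡⟨ *-cancelʳ-≡ (n + 1) (2 * k) n {{>-nonZero 1≤n}} (begin
                        (n + 1) * n   ≡⟨ *-comm (n + 1) n ⟩
                        n * (n + 1)   ≡⟨ balanced ⟩
                        2 * (k * n)   ≡⟨ *-assoc 2 k n ⟨
                        2 * k * n     ∎) ⟩
    2 * k          ≡⟨ *-identityˡ (2 * k) ⟨
    1 * (2 * k)    ∎))
    where open ≡-Reasoning

half< : ∀ {h t n} → h * 2 ≤ t → t < 2 * n → h < n
half< {h} {t} {n} h2≤t t<2n = *-cancelʳ-< 2 h n (≤-<-trans h2≤t (subst (t <_) (*-comm 2 n) t<2n))

caseIII-decompose : ∀ {n t h} → n < t → t < 2 * n → t ≡ h * 2 → ∃₂ λ m e → n ≡ suc (2 * m + e) × h ≡ suc (m + e)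
caseIII-decompose {n} {t} {h} n<t t<2n t≡2h = m , e , n≡ , h≡
  where
  open ≤-Reasoning
  m e : ℕ
  m = n ∸ h
  n≡h+m : n ≡ h + m
  n≡h+m = sym (m+[n∸m]≡n (<⇒≤ (half< {h} (≤-reflexive (sym t≡2h)) t<2n)))
  m<h : m < h
  m<h = +-cancelˡ-< h m h (begin-strict
    h + m          ≡⟨ n≡h+m ⟨
    n              <⟨ n<t ⟩
    t              ≡⟨ trans t≡2h (*-comm h 2) ⟩
    2 * h          ≡⟨ cong (h +_) (+-identityʳ h) ⟩
    h + h          ∎)
  e = h ∸ suc m
  h≡ : h ≡ suc (m + e)
  h≡ = sym (m+[n∸m]≡n m<h)
  n≡ : n ≡ suc (2 * m + e)
  n≡ = trans n≡h+m (trans (cong (_+ m) h≡) (regroup m e))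
    where
    regroup : ∀ m e → suc (m + e) + m ≡ suc (2 * m + e)
    regroup = solve-∀

caseIII-balance : ∀ m e k → suc (2 * m + e) * (suc (2 * m + e) + 1) ≡ 2 * (k * (suc (m + e) * 2)) →
  ∃ λ c → k ≡ suc (m + c) × e * (e + 1) ≡ 2 * (suc (2 * c) * suc (m + e))
caseIII-balance m e k balanced with k ≤? m
... | yes k≤m = ⊥-elim (<-irrefl refl (begin-strict
      2 * (k * t)                                ≤⟨ *-monoʳ-≤ 2 (*-monoˡ-≤ t k≤m) ⟩
      2 * (m * t)                                <⟨ m<m+n (2 * (m * t)) z<s ⟩
      2 * (m * t) + suc (2 * m + 1 + 3 * e + e * e)  ≡⟨ expand m e ⟨
      suc (2 * m + e) * (suc (2 * m + e) + 1)    ≡⟨ balanced ⟩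
      2 * (k * t)                                ∎))
  where
  open ≤-Reasoning
  t = suc (m + e) * 2
  expand : ∀ m e → suc (2 * m + e) * (suc (2 * m + e) + 1) ≡ 2 * (m * (suc (m + e) * 2)) + suc (2 * m + 1 + 3 * e + e * e)
  expand = solve-∀
... | no k≰m = c , k≡ , +-cancelˡ-≡ ((4 * m + 2) * suc (m + e)) _ _ (begin
      (4 * m + 2) * suc (m + e) + e * (e + 1)   ≡⟨ expandˡ m e ⟩
      suc (2 * m + e) * (suc (2 * m + e) + 1)   ≡⟨ balanced ⟩
      2 * (k * (suc (m + e) * 2))               ≡⟨ cong (λ x → 2 * (x * (suc (m + e) * 2))) k≡ ⟩
      2 * (suc (m + c) * (suc (m + e) * 2))     ≡⟨ expandʳ m e c ⟩
      (4 * m + 2) * suc (m + e) + 2 * (suc (2 * c) * suc (m + e)) ∎)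
  where
  open ≡-Reasoning
  c = k ∸ suc m
  k≡ : k ≡ suc (m + c)
  k≡ = sym (m+[n∸m]≡n (≰⇒> k≰m))
  expandˡ : ∀ m e → (4 * m + 2) * suc (m + e) + e * (e + 1) ≡ suc (2 * m + e) * (suc (2 * m + e) + 1)
  expandˡ = solve-∀
  expandʳ : ∀ m e c → 2 * (suc (m + c) * (suc (m + e) * 2)) ≡ (4 * m + 2) * suc (m + e) + 2 * (suc (2 * c) * suc (m + e))
  expandʳ = solve-∀

caseIIIBuild : ℕ → ℕ → ℕ → List (List ℕ) → List (List ℕ)
caseIIIBuild n t h R = pairSets n t (n ∸ h) ++ pairUp ((h ∷ []) ∷ R)

caseIII-t≡ : ∀ m e → suc (m + e) * 2 ≡ suc (2 * m + e) + suc e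
caseIII-t≡ = solve-∀

caseIII-t∸n : ∀ m e → suc (m + e) * 2 ∸ suc (2 * m + e) ≡ suc e
caseIII-t∸n m e = trans (cong (_∸ suc (2 * m + e)) (caseIII-t≡ m e)) (m+n∸m≡n (suc (2 * m + e)) (suc e))

caseIII-core : ∀ m e c → Admissible e (suc (2 * c)) (suc (m + e)) →
  Reduction (suc (2 * m + e)) (suc (m + c)) (suc (m + e) * 2) e (suc (2 * c)) (suc (m + e))
            (caseIIIBuild (suc (2 * m + e)) (suc (m + e) * 2) (suc (m + e)))
caseIII-core m e c adm = record
  { smaller = s≤s (m≤n+m e (2 * m))
  ; admissible′ = adm
  ; lift = λ famR → Family-resp (+-suc m c) refl content (Family-++ pairs (halves famR))
  }
  where
  n h t : ℕ
  n = suc (2 * m + e)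
  h = suc (m + e)
  t = h * 2
  n∸h≡m : n ∸ h ≡ m
  n∸h≡m = trans (cong (_∸ h) (regroup m e)) (m+n∸m≡n h m)
    where
    regroup : ∀ m e → suc (2 * m + e) ≡ suc (m + e) + m
    regroup = solve-∀
  pairs : Family (pairSets n t (n ∸ h)) m t (range (t ∸ n) m ++ range (suc n ∸ m) m)
  pairs = subst (λ x → Family (pairSets n t x) m t (range (t ∸ n) m ++ range (suc n ∸ m) m)) (sym n∸h≡m)
                (pairSets-family n t m m≤n (subst (n ≤_) (sym (caseIII-t≡ m e)) (m≤m+n n (suc e))))
    where
    m≤n : m ≤ n
    m≤n = m≤n⇒m≤1+n (≤-trans (m≤m+n m (m + 0)) (m≤m+n (2 * m) e))
  halves : ∀ {R} → Family R (suc (2 * c)) h (range 1 e) → Family (pairUp ((h ∷ []) ∷ R)) (suc c) t (h ∷ range 1 e)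
  halves famR = Family-resp refl (double h) ≋-refl
                  (Family-pairUp (suc c) (Family-resp (regroup c) refl ≋-refl (Family-++ single famR)))
    where
    single : Family ((h ∷ []) ∷ []) 1 h (h ∷ [])
    single = family refl (+-identityʳ h ∷ []) ≋-refl
    regroup : ∀ c → 1 + suc (2 * c) ≡ suc c + suc c
    regroup = solve-∀
    double : ∀ h → h + h ≡ h * 2
    double = solve-∀
  content : (range (t ∸ n) m ++ range (suc n ∸ m) m) ++ (h ∷ range 1 e) ≋ range 1 n
  content = begin
      (range (t ∸ n) m ++ range (suc n ∸ m) m) ++ ([ h ] ++ range 1 e)
        ≡⟨ cong₂ (λ a b → (range a m ++ range b m) ++ ([ h ] ++ range 1 e)) (caseIII-t∸n m e) upperStart ⟩
      (range (1 + e) m ++ range (suc h) m) ++ ([ h ] ++ range 1 e)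
        ≈⟨ rearrange (range (1 + e) m) (range (suc h) m) [ h ] (range 1 e) ⟩
      range 1 e ++ (range (1 + e) m ++ ([ h ] ++ range (suc h) m))
        ≡⟨ cong (λ x → range 1 e ++ (range (1 + e) m ++ range x (suc m))) (cong suc (+-comm m e)) ⟩
      range 1 e ++ (range (1 + e) m ++ range (1 + e + m) (suc m))
        ≡⟨ cong (range 1 e ++_) (range-++ (1 + e) m (suc m)) ⟩
      range 1 e ++ range (1 + e) (m + suc m)
        ≡⟨ range-++ 1 e (m + suc m) ⟩
      range 1 (e + (m + suc m))
        ≡⟨ cong (range 1) (regroup m e) ⟩
      range 1 n ∎
    where
    open ≋-Reasoning
    upperStart : suc n ∸ m ≡ suc h
    upperStart = trans (cong (_∸ m) (regroupₛ m e)) (m+n∸m≡n m (suc h))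
      where
      regroupₛ : ∀ m e → suc (suc (2 * m + e)) ≡ m + suc (suc (m + e))
      regroupₛ = solve-∀
    rearrange : ∀ A B C D → (A ++ B) ++ (C ++ D) ≋ D ++ (A ++ (C ++ B))
    rearrange A B C D = begin
      (A ++ B) ++ (C ++ D)  ≈⟨ ++-interchange-≋ A B C D ⟩
      (A ++ C) ++ (B ++ D)  ≈⟨ ≋-++ (≋-refl {A ++ C}) (++-comm-≋ B D) ⟩
      (A ++ C) ++ (D ++ B)  ≈⟨ ++-interchange-≋ A C D B ⟩
      (A ++ D) ++ (C ++ B)  ≈⟨ ≋-++ (++-comm-≋ A D) (≋-refl {C ++ B}) ⟩
      (D ++ A) ++ (C ++ B)  ≡⟨ ++-assoc D A (C ++ B) ⟩
      D ++ (A ++ (C ++ B))  ∎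
    regroup : ∀ m e → e + (m + suc m) ≡ suc (2 * m + e)
    regroup = solve-∀

caseIII-reduction : ∀ {n k t h} → Admissible n k t → ¬ (2 * k ∣ n) → ¬ (2 * k ∣ n + 1) → ¬ (2 * n ≤ t) →
  t ≡ h * 2 → Reduction n k t (t ∸ n ∸ 1) ((2 * k + t) ∸ (1 + 2 * n)) h (caseIIIBuild n t h)
caseIII-reduction {k = k} {h = h} adm@(admissible _ balanced) 2k∤n 2k∤n+1 2n≰t refl
  with caseIII-decompose {h = h} (n<t-of-∤ (1≤n-of-∤ k 2k∤n) adm 2k∤n+1) (≰⇒> 2n≰t) refl
... | m , e , refl , refl with caseIII-balance m e k balanced
... | c , refl , balanced′ =
  Reduction-resp (cong (_∸ 1) (caseIII-t∸n m e)) k′≡ refl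
    (caseIII-core m e c (admissible (m≤n⇒m≤1+n (m≤n+m e m)) balanced′))
  where
  k′≡ : 2 * suc (m + c) + suc (m + e) * 2 ∸ (1 + 2 * suc (2 * m + e)) ≡ suc (2 * c)
  k′≡ = trans (cong (_∸ (1 + 2 * suc (2 * m + e))) (regroup m e c)) (m+n∸m≡n (1 + 2 * suc (2 * m + e)) (suc (2 * c)))
    where
    regroup : ∀ m e c → 2 * suc (m + c) + suc (m + e) * 2 ≡ 1 + 2 * suc (2 * m + e) + suc (2 * c)
    regroup = solve-∀

parity : ∀ t → ∃ λ h → t ≡ h * 2 ⊎ t ≡ suc (h * 2)
parity zero = 0 , inj₁ refl
parity (suc t) with parity t
... | h , inj₁ t≡2h = h , inj₂ (cong suc t≡2h)
... | h , inj₂ t≡2h+1 = suc h , inj₁ (cong suc t≡2h+1)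

caseIV-decompose : ∀ {n t} → n < t → t < 2 * n → ¬ (2 ∣ t) →
  ∃₂ λ m e → n ≡ 2 * m + e × t ≡ suc (2 * m + 2 * e) × 1 ≤ m
caseIV-decompose {n} {t} n<t t<2n 2∤t with parity t
... | h , inj₁ t≡2h = ⊥-elim (2∤t (divides h t≡2h))
... | h , inj₂ t≡2h+1 = m , e , n≡ , t≡ , n≢0⇒n>0 m≢0
  where
  open ≤-Reasoning
  m e : ℕ
  m = n ∸ h
  n≡h+m : n ≡ h + m
  n≡h+m = sym (m+[n∸m]≡n (<⇒≤ (half< {h} (≤-trans (n≤1+n (h * 2)) (≤-reflexive (sym t≡2h+1))) t<2n)))
  m≤h : m ≤ h
  m≤h = +-cancelˡ-≤ h m h (≤-pred (begin-strict
    h + m          ≡⟨ n≡h+m ⟨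
    n              <⟨ n<t ⟩
    t              ≡⟨ t≡2h+1 ⟩
    suc (h * 2)    ≡⟨ cong suc (trans (*-comm h 2) (cong (h +_) (+-identityʳ h))) ⟩
    suc (h + h)    ∎))
  e = h ∸ m
  h≡m+e : h ≡ m + e
  h≡m+e = sym (m+[n∸m]≡n m≤h)
  n≡ : n ≡ 2 * m + e
  n≡ = trans n≡h+m (trans (cong (_+ m) h≡m+e) (regroup m e))
    where
    regroup : ∀ m e → m + e + m ≡ 2 * m + e
    regroup = solve-∀
  t≡ : t ≡ suc (2 * m + 2 * e)
  t≡ = trans t≡2h+1 (trans (cong (λ x → suc (x * 2)) h≡m+e) (regroup m e))
    where
    regroup : ∀ m e → suc ((m + e) * 2) ≡ suc (2 * m + 2 * e)
    regroup = solve-∀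
  m≢0 : m ≢ 0
  m≢0 m≡0 = <⇒≱ t<2n (begin
    2 * n                    ≡⟨ cong (2 *_) n≡ ⟩
    2 * (2 * m + e)          ≡⟨ cong (λ x → 2 * (2 * x + e)) m≡0 ⟩
    2 * e                    ≤⟨ n≤1+n (2 * e) ⟩
    suc (2 * 0 + 2 * e)      ≡⟨ cong (λ x → suc (2 * x + 2 * e)) m≡0 ⟨
    suc (2 * m + 2 * e)      ≡⟨ t≡ ⟨
    t                        ∎)

caseIV-balance : ∀ m e k → (2 * m + e) * (2 * m + e + 1) ≡ 2 * (k * suc (2 * m + 2 * e)) →
  ∃ λ c → k ≡ m + c × e * (e + 1) ≡ 2 * (c * suc (2 * m + 2 * e))
caseIV-balance m e k balanced with m ≤? k
... | yes m≤k = c , k≡ , sym (+-cancelˡ-≡ (2 * (m * t)) _ _ (begin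
      2 * (m * t) + 2 * (c * t)   ≡⟨ distrib m c t ⟨
      2 * ((m + c) * t)           ≡⟨ cong (λ x → 2 * (x * t)) k≡ ⟨
      2 * (k * t)                 ≡⟨ balanced ⟨
      (2 * m + e) * (2 * m + e + 1) ≡⟨ expand m e ⟩
      2 * (m * t) + e * (e + 1)   ∎))
  where
  open ≡-Reasoning
  t c : ℕ
  t = suc (2 * m + 2 * e)
  c = k ∸ m
  k≡ : k ≡ m + c
  k≡ = sym (m+[n∸m]≡n m≤k)
  distrib : ∀ m c t → 2 * ((m + c) * t) ≡ 2 * (m * t) + 2 * (c * t)
  distrib = solve-∀
  expand : ∀ m e → (2 * m + e) * (2 * m + e + 1) ≡ 2 * (m * suc (2 * m + 2 * e)) + e * (e + 1)
  expand = solve-∀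
... | no m≰k = ⊥-elim (<-irrefl refl (begin-strict
      2 * (k * t)                    <⟨ m<m+n (2 * (k * t)) z<s ⟩
      2 * (k * t) + 2 * t            ≡⟨ distrib k t ⟩
      2 * (suc k * t)                ≤⟨ *-monoʳ-≤ 2 (*-monoˡ-≤ t (≰⇒> m≰k)) ⟩
      2 * (m * t)                    ≤⟨ m≤m+n (2 * (m * t)) (e * (e + 1)) ⟩
      2 * (m * t) + e * (e + 1)      ≡⟨ expand m e ⟨
      (2 * m + e) * (2 * m + e + 1)  ≡⟨ balanced ⟩
      2 * (k * t)                    ∎))
  where
  open ≤-Reasoning
  t : ℕ
  t = suc (2 * m + 2 * e)
  distrib : ∀ k t → 2 * (k * t) + 2 * t ≡ 2 * (suc k * t)
  distrib = solve-∀
  expand : ∀ m e → (2 * m + e) * (2 * m + e + 1) ≡ 2 * (m * suc (2 * m + 2 * e)) + e * (e + 1)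
  expand = solve-∀

caseIVBuild : ℕ → ℕ → List (List ℕ) → List (List ℕ)
caseIVBuild n t R = pairSets n t ⌊ (2 * n + 1 ∸ t) /2⌋ ++ R

caseIV-t∸n : ∀ m e → suc (2 * m + 2 * e) ∸ (2 * m + e) ≡ suc e
caseIV-t∸n m e = trans (cong (_∸ (2 * m + e)) (regroup m e)) (m+n∸m≡n (2 * m + e) (suc e))
  where
  regroup : ∀ m e → suc (2 * m + 2 * e) ≡ 2 * m + e + suc e
  regroup = solve-∀

caseIV-pairCount : ∀ m e → ⌊ (2 * (2 * m + e) + 1 ∸ suc (2 * m + 2 * e)) /2⌋ ≡ m
caseIV-pairCount m e = begin
    ⌊ (2 * (2 * m + e) + 1 ∸ suc (2 * m + 2 * e)) /2⌋
      ≡⟨ cong (λ x → ⌊ (x ∸ suc (2 * m + 2 * e)) /2⌋) (regroup m e) ⟩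
    ⌊ (m + m + suc (2 * m + 2 * e) ∸ suc (2 * m + 2 * e)) /2⌋
      ≡⟨ cong ⌊_/2⌋ (m+n∸n≡m (m + m) (suc (2 * m + 2 * e))) ⟩
    ⌊ (m + m) /2⌋
      ≡⟨ n≡⌊n+n/2⌋ m ⟨
    m ∎
  where
  open ≡-Reasoning
  regroup : ∀ m e → 2 * (2 * m + e) + 1 ≡ m + m + suc (2 * m + 2 * e)
  regroup = solve-∀

caseIV-core : ∀ m e c → 1 ≤ m → Admissible e c (suc (2 * m + 2 * e)) →
  Reduction (2 * m + e) (m + c) (suc (2 * m + 2 * e)) e c (suc (2 * m + 2 * e))
            (caseIVBuild (2 * m + e) (suc (2 * m + 2 * e)))
caseIV-core m e c 1≤m adm = record
  { smaller = subst (e <_) (+-comm e (2 * m)) (m<m+n e (≤-trans 1≤m (m≤m+n m (m + 0))))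
  ; admissible′ = adm
  ; lift = λ famR → Family-resp refl refl content (Family-++ pairs famR)
  }
  where
  n t : ℕ
  n = 2 * m + e
  t = suc (2 * m + 2 * e)
  pairs : Family (pairSets n t ⌊ (2 * n + 1 ∸ t) /2⌋) m t (range (t ∸ n) m ++ range (suc n ∸ m) m)
  pairs = subst (λ x → Family (pairSets n t x) m t (range (t ∸ n) m ++ range (suc n ∸ m) m)) (sym (caseIV-pairCount m e))
                (pairSets-family n t m (≤-trans (m≤m+n m (m + 0)) (m≤m+n (2 * m) e)) n≤t)
    where
    n≤t : n ≤ t
    n≤t = m≤n⇒m≤1+n (+-monoʳ-≤ (2 * m) (m≤m+n e (e + 0)))
  content : (range (t ∸ n) m ++ range (suc n ∸ m) m) ++ range 1 e ≋ range 1 n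
  content = begin
      (range (t ∸ n) m ++ range (suc n ∸ m) m) ++ range 1 e
        ≡⟨ cong₂ (λ a b → (range a m ++ range b m) ++ range 1 e) (caseIV-t∸n m e) upperStart ⟩
      (range (1 + e) m ++ range (1 + e + m) m) ++ range 1 e
        ≈⟨ ++-comm-≋ (range (1 + e) m ++ range (1 + e + m) m) (range 1 e) ⟩
      range 1 e ++ (range (1 + e) m ++ range (1 + e + m) m)
        ≡⟨ cong (range 1 e ++_) (range-++ (1 + e) m m) ⟩
      range 1 e ++ range (1 + e) (m + m)
        ≡⟨ range-++ 1 e (m + m) ⟩
      range 1 (e + (m + m))
        ≡⟨ cong (range 1) (regroup m e) ⟩
      range 1 n ∎
    where
    open ≋-Reasoning
    upperStart : suc n ∸ m ≡ 1 + e + m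
    upperStart = trans (cong (_∸ m) (regroupₛ m e)) (m+n∸m≡n m (1 + e + m))
      where
      regroupₛ : ∀ m e → suc (2 * m + e) ≡ m + (1 + e + m)
      regroupₛ = solve-∀
    regroup : ∀ m e → e + (m + m) ≡ 2 * m + e
    regroup = solve-∀

caseIV-reduction : ∀ {n k t} → Admissible n k t → ¬ (2 * k ∣ n) → ¬ (2 * k ∣ n + 1) → ¬ (2 * n ≤ t) →
  ¬ (2 ∣ t) → Reduction n k t (t ∸ n ∸ 1) (k ∸ ⌊ (2 * n + 1 ∸ t) /2⌋) t (caseIVBuild n t)
caseIV-reduction {k = k} adm@(admissible _ balanced) 2k∤n 2k∤n+1 2n≰t 2∤t
  with caseIV-decompose (n<t-of-∤ (1≤n-of-∤ k 2k∤n) adm 2k∤n+1) (≰⇒> 2n≰t) 2∤t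
... | m , e , refl , refl , 1≤m with caseIV-balance m e k balanced
... | c , refl , balanced′ =
  Reduction-resp (cong (_∸ 1) (caseIV-t∸n m e)) (trans (cong (m + c ∸_) (caseIV-pairCount m e)) (m+n∸m≡n m c)) refl
    (caseIV-core m e c 1≤m (admissible (m≤n⇒m≤1+n (≤-trans (m≤m+n e (e + 0)) (m≤n+m (2 * e) (2 * m)))) balanced′))

solve : ∀ f n k t → n < f → Admissible n k t →
  Σ (List (List ℕ)) λ Ts → piSolve f n k t ≡ just Ts × Family Ts k t (range 1 n)

solve-reduced : ∀ f {n k t n′ k′ t′ build} → n ≤ f → Reduction n k t n′ k′ t′ build →
  Σ (List (List ℕ)) λ R → piSolve f n′ k′ t′ ≡ just R × Family R k′ t′ (range 1 n′)
solve-reduced f n≤f red = solve f _ _ _ (<-≤-trans (Reduction.smaller red) n≤f) (Reduction.admissible′ red)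

solve (suc f) n k t n<1+f adm@(admissible _ balanced) with (2 * k) ∣? n
... | yes (divides q n≡q·2k) = meanderEven k q , refl , meanderEven-family n k q t n≡q·2k balanced
... | no 2k∤n with (2 * k) ∣? (n + 1)
... | yes (divides q n+1≡q·2k) = meanderOdd k q , refl , meanderOdd-family n k q t n+1≡q·2k balanced
... | no 2k∤n+1 with 2 * n ≤? t
... | yes 2n≤t with caseII-reduction adm 2k∤n 2n≤t
...   | red with piSolve f (n ∸ 2 * k) k (t ∸ 2 * (n ∸ k) ∸ 1) | solve-reduced f (≤-pred n<1+f) red
...   | .(just R) | R , refl , famR = _ , refl , Reduction.lift red famR
solve (suc f) n k t n<1+f adm | no 2k∤n | no 2k∤n+1 | no 2n≰t with 2 ∣? t
... | yes (divides h t≡2h) with caseIII-reduction {h = h} adm 2k∤n 2k∤n+1 2n≰t t≡2h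
...   | red with piSolve f (t ∸ n ∸ 1) ((2 * k + t) ∸ (1 + 2 * n)) h | solve-reduced f (≤-pred n<1+f) red
...   | .(just R) | R , refl , famR = _ , refl , Reduction.lift red famR
solve (suc f) n k t n<1+f adm | no 2k∤n | no 2k∤n+1 | no 2n≰t | no 2∤t
  with caseIV-reduction adm 2k∤n 2k∤n+1 2n≰t 2∤t
... | red with piSolve f (t ∸ n ∸ 1) (k ∸ ⌊ (2 * n + 1 ∸ t) /2⌋) t | solve-reduced f (≤-pred n<1+f) red
... | .(just R) | R , refl , famR = _ , refl , Reduction.lift red famR

-- n(n+1) is even, so the hypothesis ⌊n(n+1)/2⌋ = kt says n(n+1) = 2kt.
triangle : ∀ n → ∃ λ T → n * (n + 1) ≡ T + T
triangle zero = 0 , refl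
triangle (suc n) with triangle n
... | T , n[n+1]≡2T = T + suc n , trans (step n) (trans (cong (_+ 2 * suc n) n[n+1]≡2T) (regroup T n))
  where
  step : ∀ n → suc n * (suc n + 1) ≡ n * (n + 1) + 2 * suc n
  step = solve-∀
  regroup : ∀ T n → T + T + 2 * suc n ≡ T + suc n + (T + suc n)
  regroup = solve-∀

balanced-of-⌊/2⌋ : ∀ n k t → ⌊ n * (n + 1) /2⌋ ≡ k * t → n * (n + 1) ≡ 2 * (k * t)
balanced-of-⌊/2⌋ n k t ⌊Δ⌋≡kt with triangle n
... | T , n[n+1]≡2T = begin
    n * (n + 1)           ≡⟨ n[n+1]≡2T ⟩
    T + T                 ≡⟨ cong (λ x → x + x) T≡kt ⟩
    k * t + k * t         ≡⟨ cong (k * t +_) (+-identityʳ (k * t)) ⟨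
    2 * (k * t)           ∎
  where
  open ≡-Reasoning
  T≡kt : T ≡ k * t
  T≡kt = trans (n≡⌊n+n/2⌋ T) (trans (cong ⌊_/2⌋ (sym n[n+1]≡2T)) ⌊Δ⌋≡kt)

mainTheorem1 : (n k t : ℕ) → n ≥ 1 → k ≥ 1 → t ≥ 1 → t ≥ n →
    ⌊ n * (n + 1) /2⌋ ≡ k * t →
    Σ (List (List ℕ)) (λ Ts → PiSolveOutputs n k t Ts × IsKTPartition n k t Ts)
mainTheorem1 n k t _ _ _ t≥n ⌊Δ⌋≡kt =
  let (Ts , terminates , solution) = solve (suc n) n k t (n<1+n n) (admissible t≥n (balanced-of-⌊/2⌋ n k t ⌊Δ⌋≡kt))
  in Ts , (suc n , terminates) , Family⇒partition solution
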